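{- For all integers $n>1$, $c\ge1$ and $0\le k\le (c-1)n+c\binom{n}{2}$, we have $i_c(n,k)=\sum_{j=0}^{cn-1} i_c(n-1,k-j)$.
   Context: For integers $n\ge1$, $c\ge1$, let $G_{c,n}$ be the set of colored permutations: words $\sigma=\sigma_1^{[c_1]}\cdots\sigma_n^{[c_n]}$ where $|\sigma|=\sigma_1\cdots\sigma_n$ is a permutation of $[n]$ and each color $c_i\in\{0,\dots,c-1\}$. For a permutation $\pi$ of $[n]$, $\mathrm{inv}(\pi)=|\{(i,j):i<j,\ \pi_i>\pi_j\}|$. Let $\mathrm{col}(\sigma)=c_1+\cdots+c_n$ and $\mathrm{inv}_c(\sigma)=\mathrm{inv}(|\sigma|)+\mathrm{col}(\sigma)+c\cdot|\{(i,j):1\le i<j\le n,\ \sigma_i<\sigma_j,\ c_j\ne0\}|$. Define $i_c(n,k)=|\{\sigma\in G_{c,n}:\mathrm{inv}_c(\sigma)=k\}|$ for all integers $k$ (so $i_c(n,k)=0$ for $k<0$). -}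

module Defs where

open import Data.Nat using (ℕ; zero; suc; _+_; _*_; _∸_; _<ᵇ_; _≡ᵇ_)
open import Data.Bool using (Bool; true; false; _∧_; not; if_then_else_)
open import Data.Fin using (Fin; toℕ)
open import Data.Product using (_×_; _,_; proj₁; proj₂)
open import Data.List using (List; []; _∷_; map; concatMap; length; filterᵇ; allFin; cartesianProduct)
open import Data.Nat.ListAction using (sum)
open import Data.Nat.Combinatorics using (_C_)
open import Data.Integer using (ℤ; +_; _-_)

Letter : ℕ → ℕ → Set
Letter n c = Fin n × Fin c

words : {A : Set} → List A → ℕ → List (List A)
words as zero    = [] ∷ []
words as (suc m) = concatMap (λ a → map (a ∷_) (words as m)) as

allᵇ : {A : Set} → (A → Bool) → List A → Bool
allᵇ p []       = true
allᵇ p (x ∷ xs) = p x ∧ allᵇ p xs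

-- |σ| is a permutation of [n]: the n letters are pairwise distinct
distinct : {n c : ℕ} → List (Letter n c) → Bool
distinct []       = true
distinct (x ∷ xs) = allᵇ (λ y → not (toℕ (proj₁ x) ≡ᵇ toℕ (proj₁ y))) xs ∧ distinct xs

G : (c n : ℕ) → List (List (Letter n c))
G c n = filterᵇ distinct (words (cartesianProduct (allFin n) (allFin c)) n)

count : {A : Set} → (A → Bool) → List A → ℕ
count p xs = length (filterᵇ p xs)

invW : {n c : ℕ} → List (Letter n c) → ℕ
invW []       = 0
invW (x ∷ xs) = count (λ y → toℕ (proj₁ y) <ᵇ toℕ (proj₁ x)) xs + invW xs

col : {n c : ℕ} → List (Letter n c) → ℕ
col xs = sum (map (λ y → toℕ (proj₂ y)) xs)

ascNZ : {n c : ℕ} → List (Letter n c) → ℕ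
ascNZ []       = 0
ascNZ (x ∷ xs) =
  count (λ y → (toℕ (proj₁ x) <ᵇ toℕ (proj₁ y)) ∧ not (toℕ (proj₂ y) ≡ᵇ 0)) xs + ascNZ xs

invc : (c : ℕ) {n : ℕ} → List (Letter n c) → ℕ
invc c σ = invW σ + col σ + c * ascNZ σ

-- i_c(n,k) for integer k (automatically 0 for k < 0)
ic : (c n : ℕ) → ℤ → ℕ
ic c n k = count (λ σ → isK k (invc c σ)) (G c n)
  where
  isK : ℤ → ℕ → Bool
  isK (+ k') m = m ≡ᵇ k'
  isK _      m = false

{-# OPTIONS --safe #-}
-- Sort the colored permutations of [n] by the position p and the color j of the letter n.
-- Deleting that letter leaves a colored permutation of [n-1] and lowers inv_c by exactly
-- (n-1-p) + j + c·p·[j ≠ 0]: n is inverted with the n-1-p letters after it, adds j to col,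
-- and, if j ≠ 0, closes c·p ascents.  As (p, j) runs over [0,n) × [0,c) this decrement takes
-- every value of [0, cn) exactly once.  Formally, injective words with values in [0, N] split
-- by the occurrence of the value N: either it is absent, which for words of length N + 1 is
-- impossible by pigeonhole, or deleting it leaves an injective word with values in [0, N).
module Submission where

open import Defs
open import Data.Bool using (Bool; true; false; _∧_; not; if_then_else_)
open import Data.Fin using (toℕ)
open import Data.Integer using (ℤ; +_; -[1+_]; _-_; _⊖_)
open import Data.Integer.Properties using ([+m]-[+n]≡m⊖n; [1+m]⊖[1+n]≡m⊖n)
open import Data.List
  using (List; []; _∷_; [_]; _++_; map; concatMap; upTo; applyUpTo; length; filterᵇ; allFin; tabulate; cartesianProduct)
open import Data.List.Membership.Propositional.Properties using (∈-upTo⁻)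
open import Data.List.Properties
  using (map-cong; map-cong-local; map-++; map-∘; map-upTo; upTo-∷ʳ; map-tabulate; ++-identityʳ; cartesianProductWith-distribʳ-++)
open import Data.List.Relation.Unary.All as All using (All; []; _∷_)
open import Data.List.Relation.Unary.All.Properties using (applyUpTo⁺₁; cartesianProduct⁺)
open import Data.Nat using (ℕ; zero; suc; _+_; _*_; _∸_; _≤_; _<_; _<ᵇ_; _≡ᵇ_; s≤s)
open import Data.Nat.Combinatorics using (_C_)
open import Data.Nat.ListAction using (sum)
open import Data.Nat.ListAction.Properties using (sum-++)
open import Data.Nat.Properties
  using (+-identityʳ; +-suc; +-comm; +-assoc; *-comm; m∸n+n≡m; m<1+n⇒m≤n; m<n⇒m<1+n; n<1+n; +-commutativeSemigroup)
open import Algebra.Properties.CommutativeSemigroup +-commutativeSemigroup using (interchange; x∙yz≈y∙xz)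
open import Data.Nat.Solver using (module +-*-Solver)
open import Data.Product using (_×_; _,_; proj₁; proj₂)
import Data.Product as Product
open import Function using (_∘_; id)
open import Relation.Binary.PropositionalEquality
  using (_≡_; refl; sym; trans; cong; cong₂; setoid; module ≡-Reasoning)

open +-*-Solver using (solve; _:+_; _:*_; _:=_; con)
open ≡-Reasoning

private variable
  A B A′ B′ : Set

when : Bool → ℕ → ℕ
when b n = if b then n else 0

⟦_⟧ : Bool → ℕ
⟦ b ⟧ = when b 1

when-zero : ∀ b → when b 0 ≡ 0
when-zero true  = refl
when-zero false = refl

when-∧ : ∀ a b n → when (a ∧ b) n ≡ when b (when a n)
when-∧ true  b n = refl
when-∧ false b n = sym (when-zero b)

when-comm : ∀ a b n → when a (when b n) ≡ when b (when a n)
when-comm true  b n = refl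
when-comm false b n = sym (when-zero b)

when-suc : ∀ b n → when b (suc n) ≡ ⟦ b ⟧ + when b n
when-suc true  n = refl
when-suc false n = refl

≡ᵇ-refl : ∀ n → (n ≡ᵇ n) ≡ true
≡ᵇ-refl zero    = refl
≡ᵇ-refl (suc n) = ≡ᵇ-refl n

<⇒≡ᵇ≡false : ∀ {m n} → m < n → (m ≡ᵇ n) ≡ false
<⇒≡ᵇ≡false {zero}  (s≤s _)   = refl
<⇒≡ᵇ≡false {suc m} (s≤s m<n) = <⇒≡ᵇ≡false m<n

>⇒≡ᵇ≡false : ∀ {m n} → m < n → (n ≡ᵇ m) ≡ false
>⇒≡ᵇ≡false {zero}  {suc n} _         = refl
>⇒≡ᵇ≡false {suc m} {suc n} (s≤s m<n) = >⇒≡ᵇ≡false m<n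

<⇒<ᵇ≡true : ∀ {m n} → m < n → (m <ᵇ n) ≡ true
<⇒<ᵇ≡true {zero}  (s≤s _)   = refl
<⇒<ᵇ≡true {suc m} (s≤s m<n) = <⇒<ᵇ≡true m<n

>⇒<ᵇ≡false : ∀ {m n} → m < n → (n <ᵇ m) ≡ false
>⇒<ᵇ≡false {zero}  {suc n} _         = refl
>⇒<ᵇ≡false {suc m} {suc n} (s≤s m<n) = >⇒<ᵇ≡false m<n

-- Finite sums

∑ : List A → (A → ℕ) → ℕ
∑ xs f = sum (map f xs)

syntax ∑ xs (λ x → e) = ∑[ x ∈ xs ] e

∑< : ℕ → (ℕ → ℕ) → ℕ
∑< n f = ∑ (upTo n) f

syntax ∑< n (λ i → e) = ∑[ i < n ] e

∑-cong : ∀ xs {f g : A → ℕ} → (∀ x → f x ≡ g x) → ∑ xs f ≡ ∑ xs g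
∑-cong xs f≗g = cong sum (map-cong f≗g xs)

∑-cong-All : ∀ {P : A → Set} {xs} {f g : A → ℕ} → All P xs → (∀ {x} → P x → f x ≡ g x) → ∑ xs f ≡ ∑ xs g
∑-cong-All pxs f≗g = cong sum (map-cong-local (All.map f≗g pxs))

∑-++ : ∀ xs ys (f : A → ℕ) → ∑ (xs ++ ys) f ≡ ∑ xs f + ∑ ys f
∑-++ xs ys f = trans (cong sum (map-++ f xs ys)) (sum-++ (map f xs) (map f ys))

∑-map : ∀ (h : A → B) xs (f : B → ℕ) → ∑ (map h xs) f ≡ ∑ xs (f ∘ h)
∑-map h xs f = cong sum (sym (map-∘ xs))

∑-concatMap : ∀ (h : A → List B) xs (f : B → ℕ) → ∑ (concatMap h xs) f ≡ ∑[ x ∈ xs ] ∑ (h x) f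
∑-concatMap h []       f = refl
∑-concatMap h (x ∷ xs) f = trans (∑-++ (h x) (concatMap h xs) f) (cong (_+_ (∑ (h x) f)) (∑-concatMap h xs f))

∑-zero : ∀ (xs : List A) → ∑[ x ∈ xs ] 0 ≡ 0
∑-zero []       = refl
∑-zero (x ∷ xs) = ∑-zero xs

∑-distrib-+ : ∀ xs (f g : A → ℕ) → ∑[ x ∈ xs ] (f x + g x) ≡ ∑ xs f + ∑ xs g
∑-distrib-+ []       f g = refl
∑-distrib-+ (x ∷ xs) f g =
  trans (cong (_+_ (f x + g x)) (∑-distrib-+ xs f g)) (interchange (f x) (g x) (∑ xs f) (∑ xs g))

∑-comm : ∀ xs ys (f : A → B → ℕ) → ∑[ x ∈ xs ] ∑[ y ∈ ys ] f x y ≡ ∑[ y ∈ ys ] ∑[ x ∈ xs ] f x y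
∑-comm []       ys f = sym (∑-zero ys)
∑-comm (x ∷ xs) ys f =
  trans (cong (_+_ (∑ ys (f x))) (∑-comm xs ys f)) (sym (∑-distrib-+ ys (f x) (λ y → ∑[ x′ ∈ xs ] f x′ y)))

∑-when : ∀ xs b (f : A → ℕ) → ∑[ x ∈ xs ] when b (f x) ≡ when b (∑ xs f)
∑-when xs true  f = refl
∑-when xs false f = ∑-zero xs

count≡∑ : ∀ (q : A → Bool) xs → count q xs ≡ ∑[ x ∈ xs ] ⟦ q x ⟧
count≡∑ q []       = refl
count≡∑ q (x ∷ xs) with q x
... | true  = cong suc (count≡∑ q xs)
... | false = count≡∑ q xs

∑-filterᵇ : ∀ (d : A → Bool) xs (f : A → ℕ) → ∑ (filterᵇ d xs) f ≡ ∑[ x ∈ xs ] when (d x) (f x)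
∑-filterᵇ d []       f = refl
∑-filterᵇ d (x ∷ xs) f with d x
... | true  = cong (_+_ (f x)) (∑-filterᵇ d xs f)
... | false = ∑-filterᵇ d xs f

∑<-suc : ∀ n (f : ℕ → ℕ) → ∑[ i < suc n ] f i ≡ f 0 + ∑[ i < n ] f (suc i)
∑<-suc n f = cong (_+_ (f 0)) (trans (cong (λ xs → ∑ xs f) (sym (map-upTo suc n))) (∑-map suc (upTo n) f))

∑<-suc-last : ∀ n (f : ℕ → ℕ) → ∑[ i < suc n ] f i ≡ ∑[ i < n ] f i + f n
∑<-suc-last n f = begin
  ∑ (upTo (suc n)) f        ≡⟨ cong (λ xs → ∑ xs f) (upTo-∷ʳ n) ⟨
  ∑ (upTo n ++ [ n ]) f     ≡⟨ ∑-++ (upTo n) [ n ] f ⟩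
  ∑< n f + (f n + 0)        ≡⟨ cong (_+_ (∑< n f)) (+-identityʳ (f n)) ⟩
  ∑< n f + f n              ∎

∑<-cong-< : ∀ n {f g : ℕ → ℕ} → (∀ {i} → i < n → f i ≡ g i) → ∑< n f ≡ ∑< n g
∑<-cong-< n f≗g = ∑-cong-All (applyUpTo⁺₁ id n id) f≗g

∑<-+ : ∀ m n (f : ℕ → ℕ) → ∑[ i < m + n ] f i ≡ ∑[ i < m ] f i + ∑[ i < n ] f (m + i)
∑<-+ zero    n f = refl
∑<-+ (suc m) n f = begin
  ∑< (suc m + n) f                                       ≡⟨ ∑<-suc (m + n) f ⟩
  f 0 + ∑< (m + n) (f ∘ suc)                             ≡⟨ cong (_+_ (f 0)) (∑<-+ m n (f ∘ suc)) ⟩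
  f 0 + (∑< m (f ∘ suc) + ∑[ i < n ] f (suc m + i))      ≡⟨ +-assoc (f 0) _ _ ⟨
  (f 0 + ∑< m (f ∘ suc)) + ∑[ i < n ] f (suc m + i)      ≡⟨ cong (_+ ∑[ i < n ] f (suc m + i)) (∑<-suc m f) ⟨
  ∑< (suc m) f + ∑[ i < n ] f (suc m + i)                ∎

∑<-reverse : ∀ m (f : ℕ → ℕ) → ∑[ i < suc m ] f (m ∸ i) ≡ ∑[ i < suc m ] f i
∑<-reverse zero    f = refl
∑<-reverse (suc m) f = begin
  ∑[ i < suc (suc m) ] f (suc m ∸ i)     ≡⟨ ∑<-suc (suc m) (λ i → f (suc m ∸ i)) ⟩
  f (suc m) + ∑[ i < suc m ] f (m ∸ i)   ≡⟨ cong (_+_ (f (suc m))) (∑<-reverse m f) ⟩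
  f (suc m) + ∑< (suc m) f               ≡⟨ +-comm (f (suc m)) _ ⟩
  ∑< (suc m) f + f (suc m)               ≡⟨ ∑<-suc-last (suc m) f ⟨
  ∑< (suc (suc m)) f                     ∎

∑<-* : ∀ m n (f : ℕ → ℕ) → ∑[ p < m ] ∑[ j < n ] f (p * n + j) ≡ ∑[ i < m * n ] f i
∑<-* zero    n f = refl
∑<-* (suc m) n f = begin
  ∑[ p < suc m ] ∑[ j < n ] f (p * n + j)                ≡⟨ ∑<-suc m (λ p → ∑[ j < n ] f (p * n + j)) ⟩
  ∑< n f + ∑[ p < m ] ∑[ j < n ] f (n + p * n + j)
    ≡⟨ cong (_+_ (∑< n f)) (∑-cong (upTo m) (λ p → ∑-cong (upTo n) (λ j → cong f (+-assoc n (p * n) j)))) ⟩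
  ∑< n f + ∑[ p < m ] ∑[ j < n ] f (n + (p * n + j))     ≡⟨ cong (_+_ (∑< n f)) (∑<-* m n (λ i → f (n + i))) ⟩
  ∑< n f + ∑[ i < m * n ] f (n + i)                      ≡⟨ ∑<-+ n (m * n) f ⟨
  ∑< (n + m * n) f                                       ∎

∑-words-suc : ∀ (L : List A) m (g : List A → ℕ) → ∑ (words L (suc m)) g ≡ ∑[ x ∈ L ] ∑[ w ∈ words L m ] g (x ∷ w)
∑-words-suc L m g = trans (∑-concatMap (λ x → map (x ∷_) (words L m)) L g)
                          (∑-cong L (λ x → ∑-map (x ∷_) (words L m) g))

∑-words-cong-All : ∀ {P : A → Set} {L} → All P L → ∀ m {g h : List A → ℕ} →
  (∀ {w} → All P w → length w ≡ m → g w ≡ h w) → ∑ (words L m) g ≡ ∑ (words L m) h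
∑-words-cong-All pL zero    g≗h = cong (_+ 0) (g≗h [] refl)
∑-words-cong-All {L = L} pL (suc m) {g} {h} g≗h = begin
  ∑ (words L (suc m)) g                     ≡⟨ ∑-words-suc L m g ⟩
  ∑[ x ∈ L ] ∑[ w ∈ words L m ] g (x ∷ w)
    ≡⟨ ∑-cong-All pL (λ px → ∑-words-cong-All pL m (λ pw ∣w∣≡m → g≗h (px ∷ pw) (cong suc ∣w∣≡m))) ⟩
  ∑[ x ∈ L ] ∑[ w ∈ words L m ] h (x ∷ w)   ≡⟨ ∑-words-suc L m h ⟨
  ∑ (words L (suc m)) h                     ∎

∑-words-map : ∀ (φ : A → B) L m (h : List B → ℕ) → ∑[ w ∈ words L m ] h (map φ w) ≡ ∑ (words (map φ L) m) h
∑-words-map φ L zero    h = refl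
∑-words-map φ L (suc m) h = begin
  ∑[ w ∈ words L (suc m) ] h (map φ w)                      ≡⟨ ∑-words-suc L m _ ⟩
  ∑[ x ∈ L ] ∑[ w ∈ words L m ] h (φ x ∷ map φ w)           ≡⟨ ∑-cong L (λ x → ∑-words-map φ L m (h ∘ (φ x ∷_))) ⟩
  ∑[ x ∈ L ] ∑[ w ∈ words (map φ L) m ] h (φ x ∷ w)         ≡⟨ ∑-map φ L _ ⟨
  ∑[ y ∈ map φ L ] ∑[ w ∈ words (map φ L) m ] h (y ∷ w)     ≡⟨ ∑-words-suc (map φ L) m h ⟨
  ∑ (words (map φ L) (suc m)) h                             ∎

-- Letters (value, colour) as pairs of naturals, so that the alphabets for all n share one type.
Letterℕ : Set
Letterℕ = ℕ × ℕ

Wordℕ : Set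
Wordℕ = List Letterℕ

fresh : Letterℕ → Wordℕ → Bool
fresh x = allᵇ (λ y → not (proj₁ x ≡ᵇ proj₁ y))

distinctℕ : Wordℕ → Bool
distinctℕ []      = true
distinctℕ (x ∷ w) = fresh x w ∧ distinctℕ w

invℕ : Wordℕ → ℕ
invℕ []      = 0
invℕ (x ∷ w) = count (λ y → proj₁ y <ᵇ proj₁ x) w + invℕ w

colℕ : Wordℕ → ℕ
colℕ w = ∑ w proj₂

ascℕ : Wordℕ → ℕ
ascℕ []      = 0
ascℕ (x ∷ w) = count (λ y → (proj₁ x <ᵇ proj₁ y) ∧ not (proj₂ y ≡ᵇ 0)) w + ascℕ w

invcℕ : ℕ → Wordℕ → ℕ
invcℕ c w = invℕ w + colℕ w + c * ascℕ w

-- Inserting the largest value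

insert : ℕ → A → List A → List A
insert zero    b u       = b ∷ u
insert (suc p) b []      = b ∷ []
insert (suc p) b (x ∷ u) = x ∷ insert p b u

∑-insert : ∀ p b u (f : A → ℕ) → ∑ (insert p b u) f ≡ f b + ∑ u f
∑-insert zero    b u       f = refl
∑-insert (suc p) b []      f = refl
∑-insert (suc p) b (x ∷ u) f = trans (cong (_+_ (f x)) (∑-insert p b u f)) (x∙yz≈y∙xz (f x) (f b) (∑ u f))

count-insert : ∀ (q : A → Bool) p b u → count q (insert p b u) ≡ ⟦ q b ⟧ + count q u
count-insert q p b u = begin
  count q (insert p b u)          ≡⟨ count≡∑ q (insert p b u) ⟩
  ∑ (insert p b u) (⟦_⟧ ∘ q)      ≡⟨ ∑-insert p b u (⟦_⟧ ∘ q) ⟩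
  ⟦ q b ⟧ + ∑ u (⟦_⟧ ∘ q)         ≡⟨ cong (_+_ ⟦ q b ⟧) (count≡∑ q u) ⟨
  ⟦ q b ⟧ + count q u             ∎

allᵇ-insert : ∀ {q : A → Bool} p {b} u → q b ≡ true → allᵇ q (insert p b u) ≡ allᵇ q u
allᵇ-insert zero    u qb rewrite qb = refl
allᵇ-insert (suc p) [] qb rewrite qb = refl
allᵇ-insert {q = q} (suc p) (x ∷ u) qb = cong (q x ∧_) (allᵇ-insert p u qb)

count-all : ∀ {q : A → Bool} {u} → All (λ y → q y ≡ true) u → count q u ≡ length u
count-all []                     = refl
count-all {u = y ∷ u} (qy ∷ qu) rewrite qy = cong suc (count-all qu)

count-none : ∀ {q : A → Bool} {u} → All (λ y → q y ≡ false) u → count q u ≡ 0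
count-none []                     = refl
count-none {u = y ∷ u} (qy ∷ qu) rewrite qy = count-none qu

module _ {N : ℕ} (j : ℕ) where

  inv-insert-max : ∀ p u → All ((_< N) ∘ proj₁) u → p ≤ length u →
    invℕ (insert p (N , j) u) ≡ invℕ u + (length u ∸ p)
  inv-insert-max zero u u<N _ = begin
    count (λ y → proj₁ y <ᵇ N) u + invℕ u   ≡⟨ cong (_+ invℕ u) (count-all (All.map <⇒<ᵇ≡true u<N)) ⟩
    length u + invℕ u                       ≡⟨ +-comm (length u) (invℕ u) ⟩
    invℕ u + length u                       ∎
  inv-insert-max (suc p) (x ∷ u) (x<N ∷ u<N) (s≤s p≤∣u∣) = begin
    count qₓ (insert p (N , j) u) + invℕ (insert p (N , j) u)
      ≡⟨ cong₂ _+_ (count-insert qₓ p (N , j) u) (inv-insert-max p u u<N p≤∣u∣) ⟩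
    (⟦ N <ᵇ proj₁ x ⟧ + count qₓ u) + (invℕ u + (length u ∸ p))
      ≡⟨ cong (λ b → ⟦ b ⟧ + count qₓ u + (invℕ u + (length u ∸ p))) (>⇒<ᵇ≡false x<N) ⟩
    count qₓ u + (invℕ u + (length u ∸ p))
      ≡⟨ +-assoc (count qₓ u) (invℕ u) (length u ∸ p) ⟨
    invℕ (x ∷ u) + (length u ∸ p)
      ∎
    where
    qₓ : Letterℕ → Bool
    qₓ y = proj₁ y <ᵇ proj₁ x

  asc-insert-max : ∀ p u → All ((_< N) ∘ proj₁) u → p ≤ length u →
    ascℕ (insert p (N , j) u) ≡ ascℕ u + when (not (j ≡ᵇ 0)) p
  asc-insert-max zero u u<N _ = begin
    count (λ y → (N <ᵇ proj₁ y) ∧ not (proj₂ y ≡ᵇ 0)) u + ascℕ u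
      ≡⟨ cong (_+ ascℕ u) (count-none (All.map (λ {y} y<N → cong (_∧ not (proj₂ y ≡ᵇ 0)) (>⇒<ᵇ≡false y<N)) u<N)) ⟩
    ascℕ u                                 ≡⟨ +-identityʳ (ascℕ u) ⟨
    ascℕ u + 0                             ≡⟨ cong (_+_ (ascℕ u)) (when-zero (not (j ≡ᵇ 0))) ⟨
    ascℕ u + when (not (j ≡ᵇ 0)) 0         ∎
  asc-insert-max (suc p) (x ∷ u) (x<N ∷ u<N) (s≤s p≤∣u∣) = begin
    count qₓ (insert p (N , j) u) + ascℕ (insert p (N , j) u)
      ≡⟨ cong₂ _+_ (count-insert qₓ p (N , j) u) (asc-insert-max p u u<N p≤∣u∣) ⟩
    (⟦ (proj₁ x <ᵇ N) ∧ j≢0 ⟧ + count qₓ u) + (ascℕ u + when j≢0 p)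
      ≡⟨ cong (λ b → ⟦ b ∧ j≢0 ⟧ + count qₓ u + (ascℕ u + when j≢0 p)) (<⇒<ᵇ≡true x<N) ⟩
    (⟦ j≢0 ⟧ + count qₓ u) + (ascℕ u + when j≢0 p)
      ≡⟨ solve 4 (λ a b c d → (a :+ b) :+ (c :+ d) := (b :+ c) :+ (a :+ d)) refl
           ⟦ j≢0 ⟧ (count qₓ u) (ascℕ u) (when j≢0 p) ⟩
    ascℕ (x ∷ u) + (⟦ j≢0 ⟧ + when j≢0 p)
      ≡⟨ cong (_+_ (ascℕ (x ∷ u))) (when-suc j≢0 p) ⟨
    ascℕ (x ∷ u) + when j≢0 (suc p)
      ∎
    where
    j≢0 : Bool
    j≢0 = not (j ≡ᵇ 0)
    qₓ : Letterℕ → Bool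
    qₓ y = (proj₁ x <ᵇ proj₁ y) ∧ not (proj₂ y ≡ᵇ 0)

  invc-insert-max : ∀ c p u → All ((_< N) ∘ proj₁) u → p ≤ length u →
    invcℕ c (insert p (N , j) u) ≡ invcℕ c u + ((length u ∸ p) + j + c * when (not (j ≡ᵇ 0)) p)
  invc-insert-max c p u u<N p≤∣u∣ = begin
    invℕ (insert p (N , j) u) + colℕ (insert p (N , j) u) + c * ascℕ (insert p (N , j) u)
      ≡⟨ cong₂ _+_ (cong₂ _+_ (inv-insert-max p u u<N p≤∣u∣) (∑-insert p (N , j) u proj₂))
                   (cong (c *_) (asc-insert-max p u u<N p≤∣u∣)) ⟩
    (invℕ u + d) + (j + colℕ u) + c * (ascℕ u + e)
      ≡⟨ solve 7 (λ i d j l c a e → (i :+ d) :+ (j :+ l) :+ c :* (a :+ e) := (i :+ l :+ c :* a) :+ (d :+ j :+ c :* e))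
           refl (invℕ u) d j (colℕ u) c (ascℕ u) e ⟩
    invcℕ c u + (d + j + c * e)
      ∎
    where
    d : ℕ
    d = length u ∸ p
    e : ℕ
    e = when (not (j ≡ᵇ 0)) p

-- Colour 0 yields the increments m - p ∈ [0, m]; colour j + 1 yields m + 1 + p c′ + j, which fill
-- [m + 1, c (m + 1)) block by block.
insertion-increments : ∀ c′ m (f : ℕ → ℕ) →
  ∑[ p < suc m ] ∑[ j < suc c′ ] f (m ∸ p + j + suc c′ * when (not (j ≡ᵇ 0)) p) ≡ ∑[ t < suc c′ * suc m ] f t
insertion-increments c′ m f = begin
  ∑[ p < suc m ] ∑[ j < suc c′ ] f (m ∸ p + j + suc c′ * when (not (j ≡ᵇ 0)) p)
    ≡⟨ ∑<-cong-< (suc m) (λ {p} p<1+m → trans (∑<-suc c′ (λ j → f (m ∸ p + j + suc c′ * when (not (j ≡ᵇ 0)) p)))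
         (cong₂ _+_ (cong f (colour-zero p)) (∑-cong (upTo c′) (λ j → cong f (colour-suc (m<1+n⇒m≤n p<1+m) j))))) ⟩
  ∑[ p < suc m ] (f (m ∸ p) + ∑[ j < c′ ] f (suc m + (p * c′ + j)))
    ≡⟨ ∑-distrib-+ (upTo (suc m)) (λ p → f (m ∸ p)) (λ p → ∑[ j < c′ ] f (suc m + (p * c′ + j))) ⟩
  ∑[ p < suc m ] f (m ∸ p) + ∑[ p < suc m ] ∑[ j < c′ ] f (suc m + (p * c′ + j))
    ≡⟨ cong₂ _+_ (∑<-reverse m f) (∑<-* (suc m) c′ (λ i → f (suc m + i))) ⟩
  ∑< (suc m) f + ∑[ i < suc m * c′ ] f (suc m + i)
    ≡⟨ cong (λ n → ∑< (suc m) f + ∑[ i < n ] f (suc m + i)) (*-comm (suc m) c′) ⟩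
  ∑< (suc m) f + ∑[ i < c′ * suc m ] f (suc m + i)
    ≡⟨ ∑<-+ (suc m) (c′ * suc m) f ⟨
  ∑< (suc c′ * suc m) f
    ∎
  where
  colour-zero : ∀ p → m ∸ p + 0 + suc c′ * 0 ≡ m ∸ p
  colour-zero p = solve 2 (λ d c → d :+ con 0 :+ c :* con 0 := d) refl (m ∸ p) (suc c′)
  colour-suc : ∀ {p} → p ≤ m → ∀ j → m ∸ p + suc j + suc c′ * p ≡ suc m + (p * c′ + j)
  colour-suc {p} p≤m j = begin
    m ∸ p + suc j + suc c′ * p       ≡⟨ solve 4 (λ d p j c → d :+ (con 1 :+ j) :+ (con 1 :+ c) :* p
                                                      := con 1 :+ ((d :+ p) :+ (p :* c :+ j))) refl (m ∸ p) p j c′ ⟩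
    suc (m ∸ p + p + (p * c′ + j))   ≡⟨ cong (λ n → suc (n + (p * c′ + j))) (m∸n+n≡m p≤m) ⟩
    suc m + (p * c′ + j)             ∎

-- Sums over injective words

∑ᵈ : List Letterℕ → ℕ → (Wordℕ → ℕ) → ℕ
∑ᵈ L m g = ∑[ w ∈ words L m ] when (distinctℕ w) (g w)

withHead : Letterℕ → (Wordℕ → ℕ) → Wordℕ → ℕ
withHead x g w = when (fresh x w) (g (x ∷ w))

∑ᵈ-suc : ∀ L m g → ∑ᵈ L (suc m) g ≡ ∑[ x ∈ L ] ∑ᵈ L m (withHead x g)
∑ᵈ-suc L m g = trans (∑-words-suc L m _)
  (∑-cong L (λ x → ∑-cong (words L m) (λ w → when-∧ (fresh x w) (distinctℕ w) (g (x ∷ w)))))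

∑ᵈ-cong : ∀ L m {g h : Wordℕ → ℕ} → (∀ w → g w ≡ h w) → ∑ᵈ L m g ≡ ∑ᵈ L m h
∑ᵈ-cong L m g≗h = ∑-cong (words L m) (λ w → cong (when (distinctℕ w)) (g≗h w))

∑ᵈ-cong-All : ∀ {P : Letterℕ → Set} {L} → All P L → ∀ m {g h : Wordℕ → ℕ} →
  (∀ {w} → All P w → length w ≡ m → g w ≡ h w) → ∑ᵈ L m g ≡ ∑ᵈ L m h
∑ᵈ-cong-All pL m g≗h = ∑-words-cong-All pL m (λ {w} pw ∣w∣≡m → cong (when (distinctℕ w)) (g≗h pw ∣w∣≡m))

∑-∑ᵈ-comm : ∀ xs L m (f : A → Wordℕ → ℕ) → ∑[ x ∈ xs ] ∑ᵈ L m (f x) ≡ ∑ᵈ L m (λ w → ∑[ x ∈ xs ] f x w)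
∑-∑ᵈ-comm xs L m f = trans (∑-comm xs (words L m) (λ x w → when (distinctℕ w) (f x w)))
  (∑-cong (words L m) (λ w → ∑-when xs (distinctℕ w) (λ x → f x w)))

module _ (N : ℕ) (Cs : List ℕ) {L : List Letterℕ} (L<N : All ((_< N) ∘ proj₁) L) where

  private
    L⁺ : List Letterℕ
    L⁺ = L ++ map (N ,_) Cs

  ∑-++-keyed : ∀ (f : Letterℕ → ℕ) → ∑ (L ++ map (N ,_) Cs) f ≡ ∑ L f + ∑[ j ∈ Cs ] f (N , j)
  ∑-++-keyed f = trans (∑-++ L (map (N ,_) Cs) f) (cong (_+_ (∑ L f)) (∑-map (N ,_) Cs f))

  -- fresh only looks at the value of a letter, so the colour 0 is an arbitrary choice.
  ∑-words-avoiding-key : ∀ m (h : Wordℕ → ℕ) →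
    ∑[ w ∈ words (L ++ map (N ,_) Cs) m ] when (fresh (N , 0) w) (h w) ≡ ∑ (words L m) h
  ∑-words-avoiding-key zero    h = refl
  ∑-words-avoiding-key (suc m) h = begin
    ∑[ w ∈ words L⁺ (suc m) ] when (fresh (N , 0) w) (h w)
      ≡⟨ ∑-words-suc L⁺ m _ ⟩
    ∑[ x ∈ L⁺ ] ∑[ w ∈ words L⁺ m ] when (fresh (N , 0) (x ∷ w)) (h (x ∷ w))
      ≡⟨ ∑-++-keyed _ ⟩
    ∑[ x ∈ L ] ∑[ w ∈ words L⁺ m ] when (fresh (N , 0) (x ∷ w)) (h (x ∷ w))
      + ∑[ j ∈ Cs ] ∑[ w ∈ words L⁺ m ] when (fresh (N , 0) ((N , j) ∷ w)) (h ((N , j) ∷ w))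
      ≡⟨ cong₂ _+_ (∑-cong-All L<N head-in-L) (trans (∑-cong Cs head-of-key-N) (∑-zero Cs)) ⟩
    ∑[ x ∈ L ] ∑[ w ∈ words L m ] h (x ∷ w) + 0
      ≡⟨ +-identityʳ _ ⟩
    ∑[ x ∈ L ] ∑[ w ∈ words L m ] h (x ∷ w)
      ≡⟨ ∑-words-suc L m h ⟨
    ∑ (words L (suc m)) h
      ∎
    where
    head-in-L : ∀ {x} → proj₁ x < N →
      ∑[ w ∈ words L⁺ m ] when (fresh (N , 0) (x ∷ w)) (h (x ∷ w)) ≡ ∑[ w ∈ words L m ] h (x ∷ w)
    head-in-L {x} x<N = trans
      (∑-cong (words L⁺ m) (λ w → cong (λ b → when (not b ∧ fresh (N , 0) w) (h (x ∷ w))) (>⇒≡ᵇ≡false x<N)))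
      (∑-words-avoiding-key m (h ∘ (x ∷_)))
    head-of-key-N : ∀ j → ∑[ w ∈ words L⁺ m ] when (fresh (N , 0) ((N , j) ∷ w)) (h ((N , j) ∷ w)) ≡ 0
    head-of-key-N j = trans
      (∑-cong (words L⁺ m) (λ w → cong (λ b → when (not b ∧ fresh (N , 0) w) (h ((N , j) ∷ w))) (≡ᵇ-refl N)))
      (∑-zero (words L⁺ m))

  -- A word over L ++ map (N ,_) Cs either avoids the value N, starts with it, or starts with a
  -- letter of L, after which the same case split applies to its tail.
  ∑ᵈ-++-key : ∀ m g → ∑ᵈ (L ++ map (N ,_) Cs) (suc m) g
    ≡ ∑ᵈ L (suc m) g + ∑[ p < suc m ] ∑[ j ∈ Cs ] ∑ᵈ L m (g ∘ insert p (N , j))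
  ∑ᵈ-headed-in-L : ∀ m g → ∑[ x ∈ L ] ∑ᵈ (L ++ map (N ,_) Cs) m (withHead x g)
    ≡ ∑ᵈ L (suc m) g + ∑[ p < m ] ∑[ j ∈ Cs ] ∑ᵈ L m (g ∘ insert (suc p) (N , j))

  ∑ᵈ-++-key m g = begin
    ∑ᵈ L⁺ (suc m) g
      ≡⟨ ∑ᵈ-suc L⁺ m g ⟩
    ∑[ x ∈ L⁺ ] ∑ᵈ L⁺ m (withHead x g)
      ≡⟨ ∑-++-keyed (λ x → ∑ᵈ L⁺ m (withHead x g)) ⟩
    ∑[ x ∈ L ] ∑ᵈ L⁺ m (withHead x g) + ∑[ j ∈ Cs ] ∑ᵈ L⁺ m (withHead (N , j) g)
      ≡⟨ cong₂ _+_ (∑ᵈ-headed-in-L m g) (∑-cong Cs headed-by-key-N) ⟩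
    (∑ᵈ L (suc m) g + ∑[ p < m ] inserted (suc p)) + inserted 0
      ≡⟨ +-assoc (∑ᵈ L (suc m) g) _ _ ⟩
    ∑ᵈ L (suc m) g + (∑[ p < m ] inserted (suc p) + inserted 0)
      ≡⟨ cong (_+_ (∑ᵈ L (suc m) g)) (+-comm _ (inserted 0)) ⟩
    ∑ᵈ L (suc m) g + (inserted 0 + ∑[ p < m ] inserted (suc p))
      ≡⟨ cong (_+_ (∑ᵈ L (suc m) g)) (∑<-suc m inserted) ⟨
    ∑ᵈ L (suc m) g + ∑[ p < suc m ] inserted p
      ∎
    where
    inserted : ℕ → ℕ
    inserted p = ∑[ j ∈ Cs ] ∑ᵈ L m (g ∘ insert p (N , j))
    headed-by-key-N : ∀ j → ∑ᵈ L⁺ m (withHead (N , j) g) ≡ ∑ᵈ L m (g ∘ ((N , j) ∷_))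
    headed-by-key-N j = trans
      (∑-cong (words L⁺ m) (λ w → when-comm (distinctℕ w) (fresh (N , 0) w) (g ((N , j) ∷ w))))
      (∑-words-avoiding-key m (λ w → when (distinctℕ w) (g ((N , j) ∷ w))))

  ∑ᵈ-headed-in-L zero    g = trans (sym (∑ᵈ-suc L 0 g)) (sym (+-identityʳ _))
  ∑ᵈ-headed-in-L (suc m) g = begin
    ∑[ x ∈ L ] ∑ᵈ L⁺ (suc m) (withHead x g)
      ≡⟨ ∑-cong L (λ x → ∑ᵈ-++-key m (withHead x g)) ⟩
    ∑[ x ∈ L ] (∑ᵈ L (suc m) (withHead x g) + ∑[ p < suc m ] ∑[ j ∈ Cs ] ∑ᵈ L m (withHead x g ∘ insert p (N , j)))
      ≡⟨ ∑-distrib-+ L _ _ ⟩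
    ∑[ x ∈ L ] ∑ᵈ L (suc m) (withHead x g)
      + ∑[ x ∈ L ] ∑[ p < suc m ] ∑[ j ∈ Cs ] ∑ᵈ L m (withHead x g ∘ insert p (N , j))
      ≡⟨ cong₂ _+_ (sym (∑ᵈ-suc L (suc m) g)) insertion-behind-head ⟩
    ∑ᵈ L (suc (suc m)) g + ∑[ p < suc m ] ∑[ j ∈ Cs ] ∑ᵈ L (suc m) (g ∘ insert (suc p) (N , j))
      ∎
    where
    insertion-behind-head :
      ∑[ x ∈ L ] ∑[ p < suc m ] ∑[ j ∈ Cs ] ∑ᵈ L m (withHead x g ∘ insert p (N , j))
        ≡ ∑[ p < suc m ] ∑[ j ∈ Cs ] ∑ᵈ L (suc m) (g ∘ insert (suc p) (N , j))
    insertion-behind-head = begin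
      ∑[ x ∈ L ] ∑[ p < suc m ] ∑[ j ∈ Cs ] ∑ᵈ L m (withHead x g ∘ insert p (N , j))
        ≡⟨ ∑-cong-All L<N (λ {x} x<N → ∑-cong (upTo (suc m)) (λ p → ∑-cong Cs (λ j → ∑ᵈ-cong L m (λ u →
             cong (λ b → when b (g (x ∷ insert p (N , j) u))) (allᵇ-insert p u (cong not (<⇒≡ᵇ≡false x<N))))))) ⟩
      ∑[ x ∈ L ] ∑[ p < suc m ] ∑[ j ∈ Cs ] ∑ᵈ L m (withHead x (g ∘ insert (suc p) (N , j)))
        ≡⟨ ∑-comm L (upTo (suc m)) _ ⟩
      ∑[ p < suc m ] ∑[ x ∈ L ] ∑[ j ∈ Cs ] ∑ᵈ L m (withHead x (g ∘ insert (suc p) (N , j)))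
        ≡⟨ ∑-cong (upTo (suc m)) (λ p → ∑-comm L Cs _) ⟩
      ∑[ p < suc m ] ∑[ j ∈ Cs ] ∑[ x ∈ L ] ∑ᵈ L m (withHead x (g ∘ insert (suc p) (N , j)))
        ≡⟨ ∑-cong (upTo (suc m)) (λ p → ∑-cong Cs (λ j → sym (∑ᵈ-suc L m _))) ⟩
      ∑[ p < suc m ] ∑[ j ∈ Cs ] ∑ᵈ L (suc m) (g ∘ insert (suc p) (N , j))
        ∎

∑-insertions-invc : ∀ c′ {N m} u (F : ℕ → ℕ) → All ((_< N) ∘ proj₁) u → length u ≡ m →
  ∑[ p < suc m ] ∑[ j < suc c′ ] F (invcℕ (suc c′) (insert p (N , j) u))
    ≡ ∑[ t < suc c′ * suc m ] F (invcℕ (suc c′) u + t)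
∑-insertions-invc c′ u F u<N refl = trans
  (∑<-cong-< (suc (length u)) (λ {p} p<1+∣u∣ → ∑-cong (upTo (suc c′)) (λ j →
     cong F (invc-insert-max j (suc c′) p u u<N (m<1+n⇒m≤n p<1+∣u∣)))))
  (insertion-increments c′ (length u) (λ t → F (invcℕ (suc c′) u + t)))

letters : ℕ → ℕ → List Letterℕ
letters c N = cartesianProduct (upTo N) (upTo c)

letters-suc : ∀ c N → letters c (suc N) ≡ letters c N ++ map (N ,_) (upTo c)
letters-suc c N = begin
  cartesianProduct (upTo (suc N)) (upTo c)       ≡⟨ cong (λ xs → cartesianProduct xs (upTo c)) (upTo-∷ʳ N) ⟨
  cartesianProduct (upTo N ++ [ N ]) (upTo c)    ≡⟨ cartesianProductWith-distribʳ-++ _,_ (upTo N) [ N ] (upTo c) ⟩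
  letters c N ++ (map (N ,_) (upTo c) ++ [])     ≡⟨ cong (letters c N ++_) (++-identityʳ _) ⟩
  letters c N ++ map (N ,_) (upTo c)             ∎

letters-key< : ∀ c N → All ((_< N) ∘ proj₁) (letters c N)
letters-key< c N = cartesianProduct⁺ (setoid ℕ) (setoid ℕ) (upTo N) (upTo c) (λ i∈ _ → ∈-upTo⁻ i∈)

∑ᵈ-letters-pigeonhole : ∀ c {N m} g → N < m → ∑ᵈ (letters c N) m g ≡ 0
∑ᵈ-letters-pigeonhole c {zero}  {suc m} g _         = refl
∑ᵈ-letters-pigeonhole c {suc N} {suc m} g (s≤s N<m) = begin
  ∑ᵈ (letters c (suc N)) (suc m) g
    ≡⟨ cong (λ L → ∑ᵈ L (suc m) g) (letters-suc c N) ⟩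
  ∑ᵈ (letters c N ++ map (N ,_) (upTo c)) (suc m) g
    ≡⟨ ∑ᵈ-++-key N (upTo c) (letters-key< c N) m g ⟩
  ∑ᵈ (letters c N) (suc m) g + ∑[ p < suc m ] ∑[ j < c ] ∑ᵈ (letters c N) m (g ∘ insert p (N , j))
    ≡⟨ cong₂ _+_ (∑ᵈ-letters-pigeonhole c g (m<n⇒m<1+n N<m))
         (trans (∑-cong (upTo (suc m)) (λ p → trans (∑-cong (upTo c) (λ j → ∑ᵈ-letters-pigeonhole c _ N<m))
                                                     (∑-zero (upTo c))))
                (∑-zero (upTo (suc m)))) ⟩
  0
    ∎

∑ᵈ-letters-suc : ∀ c′ N m (F : ℕ → ℕ) → let c = suc c′ in
  ∑ᵈ (letters c (suc N)) (suc m) (F ∘ invcℕ c)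
    ≡ ∑ᵈ (letters c N) (suc m) (F ∘ invcℕ c) + ∑[ t < c * suc m ] ∑ᵈ (letters c N) m (λ w → F (invcℕ c w + t))
∑ᵈ-letters-suc c′ N m F = begin
  ∑ᵈ (letters c (suc N)) (suc m) (F ∘ invcℕ c)
    ≡⟨ cong (λ L → ∑ᵈ L (suc m) (F ∘ invcℕ c)) (letters-suc c N) ⟩
  ∑ᵈ (letters c N ++ map (N ,_) (upTo c)) (suc m) (F ∘ invcℕ c)
    ≡⟨ ∑ᵈ-++-key N (upTo c) (letters-key< c N) m (F ∘ invcℕ c) ⟩
  ∑ᵈ Lₙ (suc m) (F ∘ invcℕ c) + ∑[ p < suc m ] ∑[ j < c ] ∑ᵈ Lₙ m (F ∘ invcℕ c ∘ insert p (N , j))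
    ≡⟨ cong (_+_ (∑ᵈ Lₙ (suc m) (F ∘ invcℕ c))) insertions ⟩
  ∑ᵈ Lₙ (suc m) (F ∘ invcℕ c) + ∑[ t < c * suc m ] ∑ᵈ Lₙ m (λ w → F (invcℕ c w + t))
    ∎
  where
  c : ℕ
  c = suc c′
  Lₙ : List Letterℕ
  Lₙ = letters c N
  insertions : ∑[ p < suc m ] ∑[ j < c ] ∑ᵈ Lₙ m (F ∘ invcℕ c ∘ insert p (N , j))
    ≡ ∑[ t < c * suc m ] ∑ᵈ Lₙ m (λ w → F (invcℕ c w + t))
  insertions = begin
    ∑[ p < suc m ] ∑[ j < c ] ∑ᵈ Lₙ m (F ∘ invcℕ c ∘ insert p (N , j))
      ≡⟨ ∑-cong (upTo (suc m)) (λ p → ∑-∑ᵈ-comm (upTo c) Lₙ m (λ j → F ∘ invcℕ c ∘ insert p (N , j))) ⟩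
    ∑[ p < suc m ] ∑ᵈ Lₙ m (λ u → ∑[ j < c ] F (invcℕ c (insert p (N , j) u)))
      ≡⟨ ∑-∑ᵈ-comm (upTo (suc m)) Lₙ m _ ⟩
    ∑ᵈ Lₙ m (λ u → ∑[ p < suc m ] ∑[ j < c ] F (invcℕ c (insert p (N , j) u)))
      ≡⟨ ∑ᵈ-cong-All (letters-key< c N) m (λ {u} u<N ∣u∣≡m → ∑-insertions-invc c′ u F u<N ∣u∣≡m) ⟩
    ∑ᵈ Lₙ m (λ u → ∑[ t < c * suc m ] F (invcℕ c u + t))
      ≡⟨ ∑-∑ᵈ-comm (upTo (c * suc m)) Lₙ m (λ t w → F (invcℕ c w + t)) ⟨
    ∑[ t < c * suc m ] ∑ᵈ Lₙ m (λ w → F (invcℕ c w + t))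
      ∎

-- From colored permutations to words over ℕ × ℕ

count-map : ∀ (q : B → Bool) (f : A → B) xs → count q (map f xs) ≡ count (q ∘ f) xs
count-map q f []       = refl
count-map q f (x ∷ xs) with q (f x)
... | true  = cong suc (count-map q f xs)
... | false = count-map q f xs

allᵇ-map : ∀ (q : B → Bool) (f : A → B) xs → allᵇ q (map f xs) ≡ allᵇ (q ∘ f) xs
allᵇ-map q f []       = refl
allᵇ-map q f (x ∷ xs) = cong (q (f x) ∧_) (allᵇ-map q f xs)

map-cartesianProduct : ∀ (f : A → A′) (g : B → B′) xs ys →
  map (Product.map f g) (cartesianProduct xs ys) ≡ cartesianProduct (map f xs) (map g ys)
map-cartesianProduct f g []       ys = refl
map-cartesianProduct f g (x ∷ xs) ys = trans (map-++ (Product.map f g) (map (x ,_) ys) (cartesianProduct xs ys))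
  (cong₂ _++_ (trans (sym (map-∘ ys)) (map-∘ ys)) (map-cartesianProduct f g xs ys))

tabulate-∘toℕ : ∀ n (h : ℕ → A) → tabulate (h ∘ toℕ {n}) ≡ applyUpTo h n
tabulate-∘toℕ zero    h = refl
tabulate-∘toℕ (suc n) h = cong (h 0 ∷_) (tabulate-∘toℕ n (h ∘ suc))

map-toℕ-allFin : ∀ n → map toℕ (allFin n) ≡ upTo n
map-toℕ-allFin n = trans (map-tabulate id toℕ) (tabulate-∘toℕ n id)

module _ {n c : ℕ} where

  letterToℕ : Letter n c → Letterℕ
  letterToℕ = Product.map toℕ toℕ

  distinct-toℕ : (σ : List (Letter n c)) → distinct σ ≡ distinctℕ (map letterToℕ σ)
  distinct-toℕ []      = refl
  distinct-toℕ (x ∷ σ) = cong₂ _∧_ (sym (allᵇ-map _ letterToℕ σ)) (distinct-toℕ σ)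

  inv-toℕ : (σ : List (Letter n c)) → invW σ ≡ invℕ (map letterToℕ σ)
  inv-toℕ []      = refl
  inv-toℕ (x ∷ σ) = cong₂ _+_ (sym (count-map _ letterToℕ σ)) (inv-toℕ σ)

  asc-toℕ : (σ : List (Letter n c)) → ascNZ σ ≡ ascℕ (map letterToℕ σ)
  asc-toℕ []      = refl
  asc-toℕ (x ∷ σ) = cong₂ _+_ (sym (count-map _ letterToℕ σ)) (asc-toℕ σ)

  invc-toℕ : (σ : List (Letter n c)) → invc c σ ≡ invcℕ c (map letterToℕ σ)
  invc-toℕ σ = cong₂ _+_ (cong₂ _+_ (inv-toℕ σ) (cong sum (map-∘ σ))) (cong (c *_) (asc-toℕ σ))

  letters-toℕ : map letterToℕ (cartesianProduct (allFin n) (allFin c)) ≡ letters c n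
  letters-toℕ = trans (map-cartesianProduct toℕ toℕ (allFin n) (allFin c))
                      (cong₂ cartesianProduct (map-toℕ-allFin n) (map-toℕ-allFin c))

count-G : ∀ c n (q : ℕ → Bool) → count (q ∘ invc c) (G c n) ≡ ∑ᵈ (letters c n) n (λ w → ⟦ q (invcℕ c w) ⟧)
count-G c n q = begin
  count (q ∘ invc c) (filterᵇ distinct Wₙ)                   ≡⟨ count≡∑ (q ∘ invc c) (filterᵇ distinct Wₙ) ⟩
  ∑[ σ ∈ filterᵇ distinct Wₙ ] ⟦ q (invc c σ) ⟧             ≡⟨ ∑-filterᵇ distinct Wₙ _ ⟩
  ∑[ σ ∈ Wₙ ] when (distinct σ) ⟦ q (invc c σ) ⟧
    ≡⟨ ∑-cong Wₙ (λ σ → cong₂ (λ b i → when b ⟦ q i ⟧) (distinct-toℕ σ) (invc-toℕ σ)) ⟩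
  ∑[ σ ∈ Wₙ ] h (map letterToℕ σ)                           ≡⟨ ∑-words-map letterToℕ Aₙ n h ⟩
  ∑ (words (map letterToℕ Aₙ) n) h                          ≡⟨ cong (λ L → ∑ (words L n) h) letters-toℕ ⟩
  ∑ᵈ (letters c n) n (λ w → ⟦ q (invcℕ c w) ⟧)              ∎
  where
  Aₙ : List (Letter n c)
  Aₙ = cartesianProduct (allFin n) (allFin c)
  Wₙ : List (List (Letter n c))
  Wₙ = words Aₙ n
  h : Wordℕ → ℕ
  h w = when (distinctℕ w) ⟦ q (invcℕ c w) ⟧

-- The test used by ic, which Defs keeps local.
hits : ℤ → ℕ → Bool
hits (+ k)    m = m ≡ᵇ k
hits -[1+ _ ] m = false

hits-⊖ : ∀ k t m → hits (k ⊖ t) m ≡ (m + t ≡ᵇ k)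
hits-⊖ zero    zero    m = cong (_≡ᵇ 0) (sym (+-identityʳ m))
hits-⊖ zero    (suc t) m = cong (_≡ᵇ 0) (sym (+-suc m t))
hits-⊖ (suc k) zero    m = cong (_≡ᵇ suc k) (sym (+-identityʳ m))
hits-⊖ (suc k) (suc t) m = begin
  hits (suc k ⊖ suc t) m   ≡⟨ cong (λ z → hits z m) ([1+m]⊖[1+n]≡m⊖n k t) ⟩
  hits (k ⊖ t) m           ≡⟨ hits-⊖ k t m ⟩
  (m + t ≡ᵇ k)             ≡⟨ cong (_≡ᵇ suc k) (+-suc m t) ⟨
  (m + suc t ≡ᵇ suc k)     ∎

ic≡∑ᵈ : ∀ c n z → ic c n z ≡ ∑ᵈ (letters c n) n (λ w → ⟦ hits z (invcℕ c w) ⟧)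
ic≡∑ᵈ c n (+ k)      = count-G c n (hits (+ k))
ic≡∑ᵈ c n -[1+ k ]   = count-G c n (hits -[1+ k ])

ic-shift : ∀ c n k t → ic c n (+ k - + t) ≡ ∑ᵈ (letters c n) n (λ w → ⟦ invcℕ c w + t ≡ᵇ k ⟧)
ic-shift c n k t = begin
  ic c n (+ k - + t)                                    ≡⟨ cong (ic c n) ([+m]-[+n]≡m⊖n k t) ⟩
  ic c n (k ⊖ t)                                        ≡⟨ ic≡∑ᵈ c n (k ⊖ t) ⟩
  ∑ᵈ (letters c n) n (λ w → ⟦ hits (k ⊖ t) (invcℕ c w) ⟧) ≡⟨ ∑ᵈ-cong (letters c n) n (λ w → cong ⟦_⟧ (hits-⊖ k t (invcℕ c w))) ⟩
  ∑ᵈ (letters c n) n (λ w → ⟦ invcℕ c w + t ≡ᵇ k ⟧)      ∎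

theorem3p2 : (n c k : ℕ) → 1 < n → 1 ≤ c → k ≤ (c ∸ 1) * n + c * (n C 2) →
    ic c n (+ k) ≡ sum (map (λ j → ic c (n ∸ 1) (+ k - + j)) (upTo (c * n)))
-- The recurrence holds for every k.
theorem3p2 (suc n) (suc c′) k _ _ _ = begin
  ic c (suc n) (+ k)                                                  ≡⟨ ic≡∑ᵈ c (suc n) (+ k) ⟩
  ∑ᵈ (letters c (suc n)) (suc n) (F ∘ invcℕ c)                        ≡⟨ ∑ᵈ-letters-suc c′ n n F ⟩
  ∑ᵈ (letters c n) (suc n) (F ∘ invcℕ c) + ∑[ t < c * suc n ] shifted t
    ≡⟨ cong (_+ ∑[ t < c * suc n ] shifted t) (∑ᵈ-letters-pigeonhole c (F ∘ invcℕ c) (n<1+n n)) ⟩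
  ∑[ t < c * suc n ] shifted t                                        ≡⟨ ∑-cong (upTo (c * suc n)) (ic-shift c n k) ⟨
  ∑[ t < c * suc n ] ic c n (+ k - + t)                               ∎
  where
  c : ℕ
  c = suc c′
  F : ℕ → ℕ
  F m = ⟦ m ≡ᵇ k ⟧
  shifted : ℕ → ℕ
  shifted t = ∑ᵈ (letters c n) n (λ w → F (invcℕ c w + t))
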